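{- Let $\Gamma=\langle S\rangle\le\operatorname{Sym}(\Omega)$ be a finite permutation group given by a generating set $S$, and let $\mathcal{C}(S)$ be its cycle type graph. If $\Delta_1,\Delta_2$ are orbits of $\Gamma$, then there is some $b\in\operatorname{Aut}(\mathcal{C}(S))$ with $b(\Delta_1)=\Delta_2$ if and only if $\Delta_1\equiv\Delta_2$.
   Context: Two orbits $\Delta_1,\Delta_2$ of $\Gamma\le\operatorname{Sym}(\Omega)$ are equivalent, written $\Delta_1\equiv\Delta_2$, if there is a bijection $b:\Delta_1\to\Delta_2$ such that $\varphi(b(\delta))=b(\varphi(\delta))$ for all $\varphi\in\Gamma$ and $\delta\in\Delta_1$. For $g\in\operatorname{Sym}(\Omega)$, $\operatorname{supp}(g)=\{x:g(x)\neq x\}$. Enumerate $S=\{s_1,\dots,s_m\}$. The cycle type graph $\mathcal{C}(S)$ is the vertex-colored mixed graph with vertex set the disjoint union $\Omega\,\dot\cup\,\dot\bigcup_{i=1}^m\{(i,x):x\in\operatorname{supp}(s_i)\}$ (a separate copy of each moved point for each generator); each copy $(i,x)$ is joined by an undirected edge to $x\in\Omega$; there are directed edges $(i,x)\to(i,s_i(x))$ for all $x\in\operatorname{supp}(s_i)$; vertices of $\Omega$ get color $0$ and $(i,x)$ gets color $(i,t)$ where $t$ is the length of the cycle of $s_i$ containing $x$. An automorphism of $\mathcal{C}(S)$ is a bijection of its vertices preserving colors, undirected edges, and directed edges (with direction); since it preserves color $0$, it maps $\Omega$ to $\Omega$. -}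

module Defs where

open import Data.Nat using (ℕ; zero; suc; _<_)
open import Data.Fin using (Fin)
open import Data.Fin.Subset using (Subset; _∈_)
open import Data.Fin.Permutation using (Permutation′; _⟨$⟩ʳ_; _⟨$⟩ˡ_)
open import Data.Bool using (Bool; true; false)
open import Data.List using (List; []; _∷_)
open import Data.Product using (Σ; ∃; _×_; _,_; proj₁)
open import Data.Sum using (_⊎_; inj₁; inj₂)
open import Data.Unit using (⊤)
open import Data.Empty using (⊥)
open import Relation.Nullary using (¬_)
open import Relation.Nullary.Decidable using (False)
open import Relation.Binary.PropositionalEquality using (_≡_; _≢_)
open import Data.Fin.Properties using (_≟_)
open import Function.Bundles using (_⇔_; _↔_; Inverse)

-- A word in the generators and their inverses (true = s_i, false = s_i⁻¹).
Word : ℕ → Set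
Word m = List (Fin m × Bool)

evalWord : ∀ {m n} → (Fin m → Permutation′ n) → Word m → Fin n → Fin n
evalWord S []             x = x
evalWord S ((i , true)  ∷ w) x = S i ⟨$⟩ʳ evalWord S w x
evalWord S ((i , false) ∷ w) x = S i ⟨$⟩ˡ evalWord S w x

InGroup : ∀ {m n} → (Fin m → Permutation′ n) → Permutation′ n → Set
InGroup S φ = ∃ λ (w : Word _) → ∀ x → φ ⟨$⟩ʳ x ≡ evalWord S w x

IsOrbit : ∀ {m n} → (Fin m → Permutation′ n) → Subset n → Set
IsOrbit {n = n} S Δ =
  ∃ λ (x : Fin n) → ∀ y → (y ∈ Δ) ⇔ (∃ λ φ → InGroup S φ × φ ⟨$⟩ʳ x ≡ y)

Elems : ∀ {n} → Subset n → Set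
Elems {n} Δ = Σ (Fin n) (λ x → x ∈ Δ)

-- Δ₁ ≡ Δ₂ : there is a bijection b : Δ₁ → Δ₂ with φ(b(δ)) = b(φ(δ)) for all φ ∈ Γ, δ ∈ Δ₁.
-- (Stated as: whenever φ δ = δ' with δ,δ' ∈ Δ₁, then φ (b δ) = b δ'.)
EquivOrbits : ∀ {m n} → (Fin m → Permutation′ n) → Subset n → Subset n → Set
EquivOrbits S Δ₁ Δ₂ =
  Σ (Elems Δ₁ ↔ Elems Δ₂) λ b →
    ∀ φ → InGroup S φ → ∀ (δ δ′ : Elems Δ₁) →
      φ ⟨$⟩ʳ proj₁ δ ≡ proj₁ δ′ →
      φ ⟨$⟩ʳ proj₁ (Inverse.to b δ) ≡ proj₁ (Inverse.to b δ′)

iter : ∀ {n} → Permutation′ n → ℕ → Fin n → Fin n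
iter s zero    x = x
iter s (suc k) x = s ⟨$⟩ʳ iter s k x

CycleLength : ∀ {n} → Permutation′ n → Fin n → ℕ → Set
CycleLength s x t = (0 < t) × (iter s t x ≡ x) × (∀ k → 0 < k → k < t → iter s k x ≢ x)

-- Vertices of the cycle type graph C(S): Ω ⊔ {(i,x) : x ∈ supp(s_i)}.
CopyVertex : ∀ {m n} → (Fin m → Permutation′ n) → Set
CopyVertex {m} {n} S = Σ (Fin m × Fin n) λ { (i , x) → False (S i ⟨$⟩ʳ x ≟ x) }

Vertex : ∀ {m n} → (Fin m → Permutation′ n) → Set
Vertex {n = n} S = Fin n ⊎ CopyVertex S

Colour : ℕ → Set
Colour m = ⊤ ⊎ (Fin m × ℕ)

HasColour : ∀ {m n} (S : Fin m → Permutation′ n) → Vertex S → Colour m → Set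
HasColour S (inj₁ x)               c = c ≡ inj₁ _
HasColour S (inj₂ ((i , x) , _)) c = ∃ λ t → CycleLength (S i) x t × c ≡ inj₂ (i , t)

UEdge : ∀ {m n} (S : Fin m → Permutation′ n) → Vertex S → Vertex S → Set
UEdge S (inj₁ y) (inj₁ z) = ⊥
UEdge S (inj₁ y) (inj₂ ((i , x) , _)) = x ≡ y
UEdge S (inj₂ ((i , x) , _)) (inj₁ y) = x ≡ y
UEdge S (inj₂ _) (inj₂ _) = ⊥

DEdge : ∀ {m n} (S : Fin m → Permutation′ n) → Vertex S → Vertex S → Set
DEdge S (inj₂ ((i , x) , _)) (inj₂ ((j , y) , _)) = (j ≡ i) × (y ≡ S i ⟨$⟩ʳ x)
DEdge S _ _ = ⊥

IsAut : ∀ {m n} (S : Fin m → Permutation′ n) → (Vertex S ↔ Vertex S) → Set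
IsAut {m} S b =
  (∀ v (c : Colour m) → HasColour S v c ⇔ HasColour S (Inverse.to b v) c) ×
  (∀ u v → UEdge S u v ⇔ UEdge S (Inverse.to b u) (Inverse.to b v)) ×
  (∀ u v → DEdge S u v ⇔ DEdge S (Inverse.to b u) (Inverse.to b v))

MapsOnto : ∀ {m n} (S : Fin m → Permutation′ n) → (Vertex S ↔ Vertex S) → Subset n → Subset n → Set
MapsOnto S b Δ₁ Δ₂ =
  ∀ y → (y ∈ Δ₂) ⇔ (∃ λ x → x ∈ Δ₁ × Inverse.to b (inj₁ x) ≡ inj₁ y)

-- An automorphism of C(S) preserves the colour class Ω, and the copy (i,x) is the only
-- vertex of colour (i,_) adjacent to x; so the directed edges force the restriction h of the
-- automorphism to Ω to commute with every generator, and h maps Δ₁ equivariantly onto Δ₂.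
-- Conversely, an equivariant bijection Δ₁ → Δ₂ extends, by its inverse on Δ₂ and the identity
-- elsewhere (orbits are disjoint or equal), to a permutation k of Ω centralising Γ; such a k
-- preserves supports and cycle lengths, hence lifts to the automorphism (i,x) ↦ (i,k x).
module Submission where

open import Defs
open import Data.Nat using (ℕ; suc; _+_; _<_; z≤n; s≤s)
open import Data.Nat.Properties using (+-suc; m≤n⇒∃[o]m+o≡n; ≤-refl)
open import Data.Fin using (Fin; toℕ; fromℕ; fromℕ<)
open import Data.Fin.Properties
  using (_≟_; pigeonhole; ¬∀⟶∃¬-smallest; toℕ-fromℕ; toℕ-fromℕ<; toℕ-inject)
open import Data.Fin.Subset using (Subset; _∈_; _∉_; _⊆_)
open import Data.Fin.Subset.Properties using (_∈?_)
open import Data.Fin.Permutation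
  using (Permutation′; _⟨$⟩ʳ_; _⟨$⟩ˡ_; inverseˡ; inverseʳ; permutation; flip; id; _∘ₚ_)
open import Data.Bool using (true; false)
open import Data.List using ([]; _∷_; _++_)
open import Data.Product using (Σ; ∃; _×_; _,_; proj₁; proj₂)
import Data.Product as Product
open import Data.Sum using (_⊎_; inj₁; inj₂)
open import Data.Sum.Properties using (inj₁-injective)
open import Data.Unit using (tt)
open import Data.Empty using (⊥-elim)
open import Data.Vec.Properties.WithK using ([]=-irrelevant)
open import Relation.Nullary using (¬_; Dec; yes; no; ¬?)
open import Relation.Nullary.Decidable
  using (False; toWitnessFalse; fromWitnessFalse; decidable-stable; dec-yes-irr; dec-no)
open import Relation.Unary using (Decidable)
open import Relation.Binary.PropositionalEquality
open import Function.Bundles using (_⇔_; _↔_; Inverse; Injection; mk⇔; mk↔ₛ′; Equivalence)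
open import Function.Properties.Inverse using (↔-sym; ↔⇒↣)
open import Function.Construct.Identity using (⇔-id)
open import Function.Construct.Symmetry using (⇔-sym)

open Inverse using (to; from; strictlyInverseˡ; strictlyInverseʳ)
open Equivalence using () renaming (to to ⇒; from to ⇐)
open ≡-Reasoning

∈-irrelevant : ∀ {n} {x : Fin n} {Δ : Subset n} (p q : x ∈ Δ) → p ≡ q
∈-irrelevant = []=-irrelevant

Elems-≡ : ∀ {n} {Δ : Subset n} {δ δ′ : Elems Δ} → proj₁ δ ≡ proj₁ δ′ → δ ≡ δ′
Elems-≡ {δ = x , p} {.x , q} refl = cong (x ,_) (∈-irrelevant p q)

False-irrelevant : ∀ {P : Set} {P? : Dec P} (p q : False P?) → p ≡ q
False-irrelevant {P? = yes _} () ()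
False-irrelevant {P? = no _}  _  _ = refl

↔-injective : ∀ {A B : Set} (f : A ↔ B) {x y} → to f x ≡ to f y → x ≡ y
↔-injective f = Injection.injective (↔⇒↣ f)

smallest-witness : {P : ℕ → Set} → Decidable P → ∀ {n} → P n →
                   ∃ λ t → P t × (∀ k → k < t → ¬ P k)
smallest-witness {P} P? {n} pn
  with ¬∀⟶∃¬-smallest (suc n) (λ i → ¬ P (toℕ i)) (λ i → ¬? (P? (toℕ i)))
         (λ ∀¬P → ∀¬P (fromℕ n) (subst P (sym (toℕ-fromℕ n)) pn))
... | i , ¬¬Pi , below =
  toℕ i , decidable-stable (P? (toℕ i)) ¬¬Pi ,
  λ k k<i → subst (λ j → ¬ P j) (trans (toℕ-inject (fromℕ< k<i)) (toℕ-fromℕ< k<i))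
                  (below (fromℕ< k<i))

Commute : ∀ {A : Set} → (A → A) → (A → A) → Set
Commute f g = ∀ x → f (g x) ≡ g (f x)

commute-sym : ∀ {A : Set} {f g : A → A} → Commute f g → Commute g f
commute-sym f∘g≗g∘f x = sym (f∘g≗g∘f x)

commute-from : ∀ {A : Set} (π : A ↔ A) {f : A → A} → Commute (to π) f → Commute (from π) f
commute-from π {f} comm x = begin
  from π (f x)                    ≡⟨ cong (λ y → from π (f y)) (strictlyInverseˡ π x) ⟨
  from π (f (to π (from π x)))    ≡⟨ cong (from π) (comm (from π x)) ⟨
  from π (to π (f (from π x)))    ≡⟨ strictlyInverseʳ π (f (from π x)) ⟩
  f (from π x)                    ∎

module _ {n} (s : Permutation′ n) where

  iter-+ : ∀ k a x → iter s (k + a) x ≡ iter s k (iter s a x)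
  iter-+ 0       a x = refl
  iter-+ (suc k) a x = cong (s ⟨$⟩ʳ_) (iter-+ k a x)

  iter-injective : ∀ k {x y} → iter s k x ≡ iter s k y → x ≡ y
  iter-injective 0       e = e
  iter-injective (suc k) e = iter-injective k (↔-injective s e)

  iter-commute : ∀ {f} → Commute (s ⟨$⟩ʳ_) f → ∀ k → Commute (iter s k) f
  iter-commute comm 0       x = refl
  iter-commute comm (suc k) x = trans (cong (s ⟨$⟩ʳ_) (iter-commute comm k x)) (comm _)

  iter-periodic : ∀ x → ∃ λ d → iter s (suc d) x ≡ x
  iter-periodic x with pigeonhole ≤-refl (λ (i : Fin (suc n)) → iter s (toℕ i) x)
  ... | i , j , i<j , same with m≤n⇒∃[o]m+o≡n i<j
  ... | o , 1+i+o≡j = o , sym (iter-injective (toℕ i) (begin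
    iter s (toℕ i) x                   ≡⟨ same ⟩
    iter s (toℕ j) x                   ≡⟨ cong (λ k → iter s k x) j≡i+1+o ⟩
    iter s (toℕ i + suc o) x           ≡⟨ iter-+ (toℕ i) (suc o) x ⟩
    iter s (toℕ i) (iter s (suc o) x)  ∎))
    where
    j≡i+1+o : toℕ j ≡ toℕ i + suc o
    j≡i+1+o = trans (sym 1+i+o≡j) (sym (+-suc (toℕ i) o))

  cycleLength-exists : ∀ x → ∃ (CycleLength s x)
  cycleLength-exists x with iter-periodic x
  ... | d , period with smallest-witness (λ k → iter s (suc k) x ≟ x) {d} period
  ... | t , returns , below = suc t , s≤s z≤n , returns , λ where
    (suc k) _ (s≤s k<t) → below k k<t

  cycleLength-invariant : (k : Permutation′ n) → Commute (s ⟨$⟩ʳ_) (k ⟨$⟩ʳ_) →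
                          ∀ {x t} → CycleLength s x t ⇔ CycleLength s (k ⟨$⟩ʳ x) t
  cycleLength-invariant k comm {x} {t} = mk⇔
    (λ (t>0 , returns , below) →
       t>0 , trans (iter-commute comm t x) (cong (k ⟨$⟩ʳ_) returns) ,
       λ j j>0 j<t e → below j j>0 j<t (↔-injective k (trans (sym (iter-commute comm j x)) e)))
    (λ (t>0 , returns , below) →
       t>0 , ↔-injective k (trans (sym (iter-commute comm t x)) returns) ,
       λ j j>0 j<t e → below j j>0 j<t (trans (iter-commute comm j x) (cong (k ⟨$⟩ʳ_) e)))

invariant-under-from : ∀ {A : Set} (B : A ↔ A) (P : A → Set) →
                       (∀ a → P a ⇔ P (to B a)) → ∀ a → P a ⇔ P (from B a)
invariant-under-from B P invariant a =
  ⇔-sym (subst (λ b → P (from B a) ⇔ P b) (strictlyInverseˡ B a) (invariant (from B a)))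

invariant₂-under-from : ∀ {A : Set} (B : A ↔ A) (R : A → A → Set) →
                        (∀ a b → R a b ⇔ R (to B a) (to B b)) →
                        ∀ a b → R a b ⇔ R (from B a) (from B b)
invariant₂-under-from B R invariant a b =
  ⇔-sym (subst₂ (λ a′ b′ → R (from B a) (from B b) ⇔ R a′ b′)
                (strictlyInverseˡ B a) (strictlyInverseˡ B b)
                (invariant (from B a) (from B b)))

module _ {A C : Set} (B : (A ⊎ C) ↔ (A ⊎ C))
         (to-inj₁   : ∀ a → ∃ λ a′ → to B (inj₁ a) ≡ inj₁ a′)
         (from-inj₁ : ∀ a → ∃ λ a′ → from B (inj₁ a) ≡ inj₁ a′) where

  restrict-inj₁ : A ↔ A
  restrict-inj₁ = mk↔ₛ′ to′ from′ to∘from from∘to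
    where
    to′ from′ : A → A
    to′   a = proj₁ (to-inj₁ a)
    from′ a = proj₁ (from-inj₁ a)

    to∘from : ∀ a → to′ (from′ a) ≡ a
    to∘from a = inj₁-injective (begin
      inj₁ (to′ (from′ a))    ≡⟨ proj₂ (to-inj₁ (from′ a)) ⟨
      to B (inj₁ (from′ a))   ≡⟨ cong (to B) (proj₂ (from-inj₁ a)) ⟨
      to B (from B (inj₁ a))  ≡⟨ strictlyInverseˡ B (inj₁ a) ⟩
      inj₁ a                  ∎)

    from∘to : ∀ a → from′ (to′ a) ≡ a
    from∘to a = inj₁-injective (begin
      inj₁ (from′ (to′ a))    ≡⟨ proj₂ (from-inj₁ (to′ a)) ⟨
      from B (inj₁ (to′ a))   ≡⟨ cong (from B) (proj₂ (to-inj₁ a)) ⟨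
      from B (to B (inj₁ a))  ≡⟨ strictlyInverseʳ B (inj₁ a) ⟩
      inj₁ a                  ∎)

restrict-to-Elems : ∀ {n} {Δ₁ Δ₂ : Subset n} (h : Permutation′ n) →
                    (∀ y → y ∈ Δ₂ ⇔ ∃ λ x → x ∈ Δ₁ × h ⟨$⟩ʳ x ≡ y) →
                    Elems Δ₁ ↔ Elems Δ₂
restrict-to-Elems {Δ₁ = Δ₁} h onto = mk↔ₛ′
  (λ (x , p) → h ⟨$⟩ʳ x , ⇐ (onto (h ⟨$⟩ʳ x)) (x , p , refl))
  (λ (y , q) → h ⟨$⟩ˡ y , preimage-∈ q)
  (λ _ → Elems-≡ (inverseʳ h))
  (λ _ → Elems-≡ (inverseˡ h))
  where
  preimage-∈ : ∀ {y} → y ∈ _ → h ⟨$⟩ˡ y ∈ Δ₁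
  preimage-∈ {y} q with ⇒ (onto y) q
  ... | x , p , hx≡y = subst (_∈ Δ₁) (trans (sym (inverseˡ h)) (cong (h ⟨$⟩ˡ_) hx≡y)) p

extend : ∀ {n} (Δ₁ Δ₂ : Subset n) → Elems Δ₁ ↔ Elems Δ₂ → Fin n → Fin n
extend Δ₁ Δ₂ b x with x ∈? Δ₁ | x ∈? Δ₂
... | yes p | _     = proj₁ (to b (x , p))
... | no _  | yes q = proj₁ (from b (x , q))
... | no _  | no _  = x

module _ {n} {Δ₁ Δ₂ : Subset n} (b : Elems Δ₁ ↔ Elems Δ₂) {x : Fin n} where

  extend-∈₁ : (p : x ∈ Δ₁) → extend Δ₁ Δ₂ b x ≡ proj₁ (to b (x , p))
  extend-∈₁ p rewrite dec-yes-irr (x ∈? Δ₁) ∈-irrelevant p = refl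

  extend-∈₂ : x ∉ Δ₁ → (q : x ∈ Δ₂) → extend Δ₁ Δ₂ b x ≡ proj₁ (from b (x , q))
  extend-∈₂ x∉Δ₁ q
    rewrite dec-no (x ∈? Δ₁) x∉Δ₁ | dec-yes-irr (x ∈? Δ₂) ∈-irrelevant q = refl

  extend-∉ : x ∉ Δ₁ → x ∉ Δ₂ → extend Δ₁ Δ₂ b x ≡ x
  extend-∉ x∉Δ₁ x∉Δ₂ rewrite dec-no (x ∈? Δ₁) x∉Δ₁ | dec-no (x ∈? Δ₂) x∉Δ₂ = refl

module _ {m n} (S : Fin m → Permutation′ n) where

  wordPermutation : Word m → Permutation′ n
  wordPermutation []                = id
  wordPermutation ((i , true)  ∷ w) = wordPermutation w ∘ₚ S i
  wordPermutation ((i , false) ∷ w) = wordPermutation w ∘ₚ flip (S i)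

  wordPermutation-correct : ∀ w x → wordPermutation w ⟨$⟩ʳ x ≡ evalWord S w x
  wordPermutation-correct []                x = refl
  wordPermutation-correct ((i , true)  ∷ w) x = cong (S i ⟨$⟩ʳ_) (wordPermutation-correct w x)
  wordPermutation-correct ((i , false) ∷ w) x = cong (S i ⟨$⟩ˡ_) (wordPermutation-correct w x)

  evalWord-++ : ∀ w v x → evalWord S (w ++ v) x ≡ evalWord S w (evalWord S v x)
  evalWord-++ []                v x = refl
  evalWord-++ ((i , true)  ∷ w) v x = cong (S i ⟨$⟩ʳ_) (evalWord-++ w v x)
  evalWord-++ ((i , false) ∷ w) v x = cong (S i ⟨$⟩ˡ_) (evalWord-++ w v x)

  generator-InGroup : ∀ i → InGroup S (S i)
  generator-InGroup i = (i , true) ∷ [] , λ _ → refl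

  Centralises : (Fin n → Fin n) → Set
  Centralises k = ∀ i → Commute (S i ⟨$⟩ʳ_) k

  centralises-flip : (k : Permutation′ n) → Centralises (k ⟨$⟩ʳ_) → Centralises (k ⟨$⟩ˡ_)
  centralises-flip k c i =
    commute-sym {f = k ⟨$⟩ˡ_} (commute-from k (commute-sym {f = S i ⟨$⟩ʳ_} (c i)))

  centralises-evalWord : ∀ {k} → Centralises k → ∀ w → Commute (evalWord S w) k
  centralises-evalWord c []                x = refl
  centralises-evalWord c ((i , true)  ∷ w) x =
    trans (cong (S i ⟨$⟩ʳ_) (centralises-evalWord c w x)) (c i _)
  centralises-evalWord c ((i , false) ∷ w) x =
    trans (cong (S i ⟨$⟩ˡ_) (centralises-evalWord c w x)) (commute-from (S i) (c i) _)

  centralises-InGroup : ∀ {k φ} → Centralises k → InGroup S φ → Commute (φ ⟨$⟩ʳ_) k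
  centralises-InGroup {k} {φ} c (w , φ≗w) x = begin
    φ ⟨$⟩ʳ k x         ≡⟨ φ≗w (k x) ⟩
    evalWord S w (k x)  ≡⟨ centralises-evalWord c w x ⟩
    k (evalWord S w x)  ≡⟨ cong k (φ≗w x) ⟨
    k (φ ⟨$⟩ʳ x)       ∎

  orbit-closed : ∀ {Δ} → IsOrbit S Δ → ∀ w {y} → y ∈ Δ → evalWord S w y ∈ Δ
  orbit-closed (x₀ , orbit) w {y} y∈Δ with ⇒ (orbit y) y∈Δ
  ... | φ , (v , φ≗v) , φx₀≡y =
    ⇐ (orbit _) (wordPermutation (w ++ v) , (w ++ v , wordPermutation-correct (w ++ v)) , (begin
      wordPermutation (w ++ v) ⟨$⟩ʳ x₀  ≡⟨ wordPermutation-correct (w ++ v) x₀ ⟩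
      evalWord S (w ++ v) x₀            ≡⟨ evalWord-++ w v x₀ ⟩
      evalWord S w (evalWord S v x₀)    ≡⟨ cong (evalWord S w) (trans (sym (φ≗v x₀)) φx₀≡y) ⟩
      evalWord S w y                    ∎))

  orbit-closed⁻ : ∀ {Δ} → IsOrbit S Δ → ∀ w {x} → evalWord S w x ∈ Δ → x ∈ Δ
  orbit-closed⁻ O [] p = p
  orbit-closed⁻ {Δ} O ((i , true) ∷ w) p =
    orbit-closed⁻ O w (subst (_∈ Δ) (inverseˡ (S i)) (orbit-closed O ((i , false) ∷ []) p))
  orbit-closed⁻ {Δ} O ((i , false) ∷ w) p =
    orbit-closed⁻ O w (subst (_∈ Δ) (inverseʳ (S i)) (orbit-closed O ((i , true) ∷ []) p))

  step-closed : ∀ {Δ} → IsOrbit S Δ → ∀ i {y} → y ∈ Δ → S i ⟨$⟩ʳ y ∈ Δ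
  step-closed O i = orbit-closed O ((i , true) ∷ [])

  step-closed⁻ : ∀ {Δ} → IsOrbit S Δ → ∀ i {y} → S i ⟨$⟩ʳ y ∈ Δ → y ∈ Δ
  step-closed⁻ O i = orbit-closed⁻ O ((i , true) ∷ [])

  orbits-nested : ∀ {Δ₁ Δ₂} → IsOrbit S Δ₁ → IsOrbit S Δ₂ →
                  ∀ {y} → y ∈ Δ₁ → y ∈ Δ₂ → Δ₁ ⊆ Δ₂
  orbits-nested {Δ₂ = Δ₂} (x₁ , orbit₁) O₂ {y} y∈Δ₁ y∈Δ₂ {z} z∈Δ₁
    with ⇒ (orbit₁ y) y∈Δ₁ | ⇒ (orbit₁ z) z∈Δ₁
  ... | φ , (w , φ≗w) , φx₁≡y | χ , (v , χ≗v) , χx₁≡z =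
    subst (_∈ Δ₂) (trans (sym (χ≗v x₁)) χx₁≡z) (orbit-closed O₂ v x₁∈Δ₂)
    where
    x₁∈Δ₂ : x₁ ∈ Δ₂
    x₁∈Δ₂ = orbit-closed⁻ O₂ w (subst (_∈ Δ₂) (trans (sym φx₁≡y) (φ≗w x₁)) y∈Δ₂)

  -- Restricting automorphisms to Ω

  IsAut-sym : ∀ {B} → IsAut S B → IsAut S (↔-sym B)
  IsAut-sym {B} (colour , uedge , dedge) =
    (λ v c → invariant-under-from B (λ u → HasColour S u c) (λ u → colour u c) v) ,
    invariant₂-under-from B (UEdge S) uedge ,
    invariant₂-under-from B (DEdge S) dedge

  colour-zero-is-point : ∀ v → HasColour S v (inj₁ tt) → ∃ λ y → v ≡ inj₁ y
  colour-zero-is-point (inj₁ y) _ = y , refl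
  colour-zero-is-point (inj₂ _) (_ , _ , ())

  copy-colour : ∀ i x pf → ∃ λ t → HasColour S (inj₂ ((i , x) , pf)) (inj₂ (i , t))
  copy-colour i x pf with cycleLength-exists (S i) x
  ... | t , cycle = t , t , cycle , refl

  coloured-neighbour-is-copy : ∀ u {i y t} → UEdge S u (inj₁ y) → HasColour S u (inj₂ (i , t)) →
                               Σ (False (S i ⟨$⟩ʳ y ≟ y)) λ pf → u ≡ inj₂ ((i , y) , pf)
  coloured-neighbour-is-copy (inj₂ ((i , x) , pf)) refl (_ , _ , refl) = pf , refl

  module _ {B : Vertex S ↔ Vertex S} (aut : IsAut S B) where

    automorphism-on-points : ∀ x → ∃ λ y → to B (inj₁ x) ≡ inj₁ y
    automorphism-on-points x =
      colour-zero-is-point (to B (inj₁ x)) (⇒ (proj₁ aut (inj₁ x) (inj₁ tt)) refl)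

    copy-image : ∀ {i x y} → to B (inj₁ x) ≡ inj₁ y → (pf : False (S i ⟨$⟩ʳ x ≟ x)) →
                 Σ (False (S i ⟨$⟩ʳ y ≟ y)) λ pf′ → to B (inj₂ ((i , x) , pf)) ≡ inj₂ ((i , y) , pf′)
    copy-image {i} {x} Bx≡y pf =
      coloured-neighbour-is-copy (to B copy)
        (subst (UEdge S (to B copy)) Bx≡y (⇒ (proj₁ (proj₂ aut) copy (inj₁ x)) refl))
        (⇒ (proj₁ aut copy _) (proj₂ (copy-colour i x pf)))
      where copy = inj₂ ((i , x) , pf)

    fixed-point-reflected : ∀ {i x y} → to B (inj₁ x) ≡ inj₁ y → S i ⟨$⟩ʳ y ≡ y → S i ⟨$⟩ʳ x ≡ x
    fixed-point-reflected {i} {x} Bx≡y fixed with S i ⟨$⟩ʳ x ≟ x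
    ... | yes x-fixed = x-fixed
    ... | no x-moved =
      ⊥-elim (toWitnessFalse (proj₁ (copy-image Bx≡y (fromWitnessFalse x-moved))) fixed)

  module _ {B : Vertex S ↔ Vertex S} (aut : IsAut S B) where

    -- A moved point is joined by a directed edge of copies to its image; a fixed point has
    -- no copy, which is detected through the inverse automorphism.
    automorphism-commutes : ∀ {i x y} → to B (inj₁ x) ≡ inj₁ y →
                            to B (inj₁ (S i ⟨$⟩ʳ x)) ≡ inj₁ (S i ⟨$⟩ʳ y)
    automorphism-commutes {i} {x} {y} Bx≡y with S i ⟨$⟩ʳ x ≟ x
    ... | yes x-fixed = begin
      to B (inj₁ (S i ⟨$⟩ʳ x))  ≡⟨ cong (λ z → to B (inj₁ z)) x-fixed ⟩
      to B (inj₁ x)             ≡⟨ Bx≡y ⟩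
      inj₁ y                    ≡⟨ cong inj₁ y-fixed ⟨
      inj₁ (S i ⟨$⟩ʳ y)         ∎
      where
      B⁻¹y≡x : from B (inj₁ y) ≡ inj₁ x
      B⁻¹y≡x = trans (cong (from B) (sym Bx≡y)) (strictlyInverseʳ B (inj₁ x))
      y-fixed : S i ⟨$⟩ʳ y ≡ y
      y-fixed = fixed-point-reflected {↔-sym B} (IsAut-sym {B} aut) B⁻¹y≡x x-fixed
    ... | no x-moved = trans Bsx≡y′ (cong inj₁ (proj₂ edge-image))
      where
      y′ = proj₁ (automorphism-on-points {B} aut (S i ⟨$⟩ʳ x))
      Bsx≡y′ = proj₂ (automorphism-on-points {B} aut (S i ⟨$⟩ʳ x))
      sx-moved : False (S i ⟨$⟩ʳ (S i ⟨$⟩ʳ x) ≟ S i ⟨$⟩ʳ x)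
      sx-moved = fromWitnessFalse (λ e → x-moved (↔-injective (S i) e))
      copy copy′ : Vertex S
      copy = inj₂ ((i , x) , fromWitnessFalse x-moved)
      copy′ = inj₂ ((i , S i ⟨$⟩ʳ x) , sx-moved)
      image = copy-image {B} aut Bx≡y (fromWitnessFalse x-moved)
      image′ = copy-image {B} aut Bsx≡y′ sx-moved
      edge-image : DEdge S (inj₂ ((i , y) , proj₁ image)) (inj₂ ((i , y′) , proj₁ image′))
      edge-image = subst₂ (DEdge S) (proj₂ image) (proj₂ image′)
                          (⇒ (proj₂ (proj₂ aut) copy copy′) (refl , refl))

    pointRestriction : Permutation′ n
    pointRestriction = restrict-inj₁ B (automorphism-on-points {B} aut)
                                       (automorphism-on-points {↔-sym B} (IsAut-sym {B} aut))

    pointRestriction-spec : ∀ x → to B (inj₁ x) ≡ inj₁ (pointRestriction ⟨$⟩ʳ x)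
    pointRestriction-spec x = proj₂ (automorphism-on-points {B} aut x)

    pointRestriction-centralises : Centralises (pointRestriction ⟨$⟩ʳ_)
    pointRestriction-centralises i x = inj₁-injective
      (trans (sym (automorphism-commutes (pointRestriction-spec x)))
             (pointRestriction-spec (S i ⟨$⟩ʳ x)))

    pointRestriction-onto : ∀ {Δ₁ Δ₂} → MapsOnto S B Δ₁ Δ₂ →
                            ∀ y → y ∈ Δ₂ ⇔ ∃ λ x → x ∈ Δ₁ × pointRestriction ⟨$⟩ʳ x ≡ y
    pointRestriction-onto onto y = mk⇔
      (λ q → Product.map₂ (Product.map₂ λ e →
                inj₁-injective (trans (sym (pointRestriction-spec _)) e)) (⇒ (onto y) q))
      (λ r → ⇐ (onto y) (Product.map₂ (Product.map₂ λ e →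
                trans (pointRestriction-spec _) (cong inj₁ e)) r))

    automorphism⇒equivalent : ∀ {Δ₁ Δ₂} → MapsOnto S B Δ₁ Δ₂ → EquivOrbits S Δ₁ Δ₂
    automorphism⇒equivalent onto =
      restrict-to-Elems pointRestriction (pointRestriction-onto onto) ,
      λ φ φ∈Γ (x , _) (x′ , _) φx≡x′ →
        trans (centralises-InGroup {pointRestriction ⟨$⟩ʳ_} {φ} pointRestriction-centralises φ∈Γ x)
              (cong (pointRestriction ⟨$⟩ʳ_) φx≡x′)

  -- Lifting the centraliser of Γ to automorphisms

  module _ (k : Permutation′ n) (c : Centralises (k ⟨$⟩ʳ_)) where

    support-invariant : ∀ i {x} → False (S i ⟨$⟩ʳ x ≟ x) → False (S i ⟨$⟩ʳ (k ⟨$⟩ʳ x) ≟ k ⟨$⟩ʳ x)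
    support-invariant i {x} moved =
      fromWitnessFalse (λ e → toWitnessFalse moved (↔-injective k (trans (sym (c i x)) e)))

    liftVertex : Vertex S → Vertex S
    liftVertex (inj₁ x)              = inj₁ (k ⟨$⟩ʳ x)
    liftVertex (inj₂ ((i , x) , pf)) = inj₂ ((i , k ⟨$⟩ʳ x) , support-invariant i pf)

    liftVertex-colour : ∀ v col → HasColour S v col ⇔ HasColour S (liftVertex v) col
    liftVertex-colour (inj₁ x)              col = ⇔-id _
    liftVertex-colour (inj₂ ((i , x) , pf)) col = mk⇔
      (Product.map₂ (Product.map₁ (⇒ (cycleLength-invariant (S i) k (c i)))))
      (Product.map₂ (Product.map₁ (⇐ (cycleLength-invariant (S i) k (c i)))))

    liftVertex-uedge : ∀ u v → UEdge S u v ⇔ UEdge S (liftVertex u) (liftVertex v)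
    liftVertex-uedge (inj₁ _) (inj₁ _) = ⇔-id _
    liftVertex-uedge (inj₁ _) (inj₂ _) = mk⇔ (cong (k ⟨$⟩ʳ_)) (↔-injective k)
    liftVertex-uedge (inj₂ _) (inj₁ _) = mk⇔ (cong (k ⟨$⟩ʳ_)) (↔-injective k)
    liftVertex-uedge (inj₂ _) (inj₂ _) = ⇔-id _

    liftVertex-dedge : ∀ u v → DEdge S u v ⇔ DEdge S (liftVertex u) (liftVertex v)
    liftVertex-dedge (inj₁ _) _        = ⇔-id _
    liftVertex-dedge (inj₂ _) (inj₁ _) = ⇔-id _
    liftVertex-dedge (inj₂ ((i , x) , _)) (inj₂ _) = mk⇔
      (Product.map₂ (λ e → trans (cong (k ⟨$⟩ʳ_) e) (sym (c i x))))
      (Product.map₂ (λ e → ↔-injective k (trans e (c i x))))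

  copy-≡ : ∀ {i x x′} {pf : False (S i ⟨$⟩ʳ x ≟ x)} {pf′ : False (S i ⟨$⟩ʳ x′ ≟ x′)} →
           x ≡ x′ → _≡_ {A = Vertex S} (inj₂ ((i , x) , pf)) (inj₂ ((i , x′) , pf′))
  copy-≡ {pf = pf} {pf′} refl = cong (λ q → inj₂ (_ , q)) (False-irrelevant pf pf′)

  liftVertex-inverse : (k : Permutation′ n) (c : Centralises (k ⟨$⟩ʳ_))
                       (c⁻¹ : Centralises (k ⟨$⟩ˡ_)) →
                       ∀ v → liftVertex k c (liftVertex (flip k) c⁻¹ v) ≡ v
  liftVertex-inverse k c c⁻¹ (inj₁ x)              = cong inj₁ (inverseʳ k)
  liftVertex-inverse k c c⁻¹ (inj₂ ((i , x) , pf)) = copy-≡ (inverseʳ k)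

  lift : (k : Permutation′ n) → Centralises (k ⟨$⟩ʳ_) → Vertex S ↔ Vertex S
  lift k c = mk↔ₛ′ (liftVertex k c) (liftVertex (flip k) c⁻¹)
                   (liftVertex-inverse k c c⁻¹) (liftVertex-inverse (flip k) c⁻¹ c)
    where c⁻¹ = centralises-flip k c

  lift-IsAut : (k : Permutation′ n) (c : Centralises (k ⟨$⟩ʳ_)) → IsAut S (lift k c)
  lift-IsAut k c = liftVertex-colour k c , liftVertex-uedge k c , liftVertex-dedge k c

  GeneratorEquivariant : ∀ {Δ₁ Δ₂} → (Elems Δ₁ → Elems Δ₂) → Set
  GeneratorEquivariant {Δ₁} f = ∀ i (δ δ′ : Elems Δ₁) → S i ⟨$⟩ʳ proj₁ δ ≡ proj₁ δ′ →
                                S i ⟨$⟩ʳ proj₁ (f δ) ≡ proj₁ (f δ′)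

  generatorEquivariant-from : ∀ {Δ₁ Δ₂} → IsOrbit S Δ₁ → (b : Elems Δ₁ ↔ Elems Δ₂) →
                              GeneratorEquivariant (to b) → GeneratorEquivariant (from b)
  generatorEquivariant-from {Δ₁} O₁ b equivariant i ε ε′ sε≡ε′ = begin
    proj₁ δ″                  ≡⟨ cong proj₁ (strictlyInverseʳ b δ″) ⟨
    proj₁ (from b (to b δ″))  ≡⟨ cong (λ e → proj₁ (from b e)) bδ″≡ε′ ⟩
    proj₁ (from b ε′)         ∎
    where
    δ = from b ε
    δ″ : Elems Δ₁
    δ″ = S i ⟨$⟩ʳ proj₁ δ , step-closed O₁ i (proj₂ δ)
    bδ″≡ε′ : to b δ″ ≡ ε′
    bδ″≡ε′ = Elems-≡ (begin
      proj₁ (to b δ″)          ≡⟨ equivariant i δ δ″ refl ⟨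
      S i ⟨$⟩ʳ proj₁ (to b δ)  ≡⟨ cong (λ e → S i ⟨$⟩ʳ proj₁ e) (strictlyInverseˡ b ε) ⟩
      S i ⟨$⟩ʳ proj₁ ε         ≡⟨ sε≡ε′ ⟩
      proj₁ ε′                 ∎)

  module _ {Δ₁ Δ₂ : Subset n} (O₁ : IsOrbit S Δ₁) (O₂ : IsOrbit S Δ₂)
           (b : Elems Δ₁ ↔ Elems Δ₂) where

    -- Orbits meeting are equal, so b⁻¹ maps Δ₂ ∖ Δ₁ outside Δ₂.
    extend-inverse : ∀ x → extend Δ₂ Δ₁ (↔-sym b) (extend Δ₁ Δ₂ b x) ≡ x
    extend-inverse x with x ∈? Δ₁ | x ∈? Δ₂
    ... | yes p | _ = trans (extend-∈₁ (↔-sym b) (proj₂ (to b (x , p))))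
                            (cong proj₁ (strictlyInverseʳ b (x , p)))
    ... | no x∉Δ₁ | yes q = trans (extend-∈₂ (↔-sym b) δ∉Δ₂ (proj₂ δ))
                                  (cong proj₁ (strictlyInverseˡ b (x , q)))
      where
      δ = from b (x , q)
      δ∉Δ₂ : proj₁ δ ∉ Δ₂
      δ∉Δ₂ δ∈Δ₂ = x∉Δ₁ (orbits-nested O₂ O₁ δ∈Δ₂ (proj₂ δ) q)
    ... | no x∉Δ₁ | no x∉Δ₂ = extend-∉ (↔-sym b) x∉Δ₂ x∉Δ₁

    extend-centralises : GeneratorEquivariant (to b) → Centralises (extend Δ₁ Δ₂ b)
    extend-centralises equivariant i x with x ∈? Δ₁ | x ∈? Δ₂
    ... | yes p | _ =
      trans (equivariant i (x , p) (_ , sx∈Δ₁) refl) (sym (extend-∈₁ b sx∈Δ₁))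
      where sx∈Δ₁ = step-closed O₁ i p
    ... | no x∉Δ₁ | yes q =
      trans (generatorEquivariant-from O₁ b equivariant i (x , q) (_ , sx∈Δ₂) refl)
            (sym (extend-∈₂ b (λ sx∈Δ₁ → x∉Δ₁ (step-closed⁻ O₁ i sx∈Δ₁)) sx∈Δ₂))
      where sx∈Δ₂ = step-closed O₂ i q
    ... | no x∉Δ₁ | no x∉Δ₂ =
      sym (extend-∉ b (λ sx∈Δ₁ → x∉Δ₁ (step-closed⁻ O₁ i sx∈Δ₁))
                      (λ sx∈Δ₂ → x∉Δ₂ (step-closed⁻ O₂ i sx∈Δ₂)))

  extension : ∀ {Δ₁ Δ₂} → IsOrbit S Δ₁ → IsOrbit S Δ₂ → Elems Δ₁ ↔ Elems Δ₂ → Permutation′ n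
  extension {Δ₁} {Δ₂} O₁ O₂ b =
    permutation (extend Δ₁ Δ₂ b) (extend Δ₂ Δ₁ (↔-sym b))
                (extend-inverse O₂ O₁ (↔-sym b)) (extend-inverse O₁ O₂ b)

  equivalent⇒automorphism : ∀ {Δ₁ Δ₂} → IsOrbit S Δ₁ → IsOrbit S Δ₂ → EquivOrbits S Δ₁ Δ₂ →
                            Σ (Vertex S ↔ Vertex S) λ B → IsAut S B × MapsOnto S B Δ₁ Δ₂
  equivalent⇒automorphism {Δ₁} {Δ₂} O₁ O₂ (b , equivariant) = lift k c , lift-IsAut k c , onto
    where
    k = extension O₁ O₂ b
    c = extend-centralises O₁ O₂ b (λ i → equivariant (S i) (generator-InGroup i))
    onto : MapsOnto S (lift k c) Δ₁ Δ₂
    onto y = mk⇔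
      (λ q → proj₁ (from b (y , q)) , proj₂ (from b (y , q)) , cong inj₁ (trans
               (extend-∈₁ b (proj₂ (from b (y , q)))) (cong proj₁ (strictlyInverseˡ b (y , q)))))
      (λ (x , p , kx≡y) → subst (_∈ Δ₂) (trans (sym (extend-∈₁ b p)) (inj₁-injective kx≡y))
                                 (proj₂ (to b (x , p))))

lemma7 : ∀ {m n} (S : Fin m → Permutation′ n) (Δ₁ Δ₂ : Subset n) →
    IsOrbit S Δ₁ → IsOrbit S Δ₂ →
    (Σ (Vertex S ↔ Vertex S) (λ b → IsAut S b × MapsOnto S b Δ₁ Δ₂)) ⇔ EquivOrbits S Δ₁ Δ₂
lemma7 S Δ₁ Δ₂ O₁ O₂ = mk⇔
  (λ (B , aut , onto) → automorphism⇒equivalent S {B} aut onto)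
  (equivalent⇒automorphism S O₁ O₂)
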